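{- Let $q$ be an odd prime power, fix $\epsilon\in\mathbb{F}_{q^2}\setminus\mathbb{F}_q$ with $\epsilon^q=-\epsilon$, and put $\delta=\epsilon^2\in\mathbb{F}_q$. Let $\mathcal{F}$ be the set of points of $\mathrm{PG}(3,q^2)$ with $J=0$ and $X^{q+1}+Y^{q+1}=0$. Then the lines $r_P$, $P\in\mathcal{F}$, form a partition of the point set of $\mathrm{PG}(6,q)$ given by \[ x_0=0,\qquad x_1^2-\delta x_2^2+x_3^2-\delta x_4^2=0 . \]
   Context: Points of $\mathrm{PG}(3,q^2)$ have homogeneous coordinates $(J,X,Y,Z)$ and points of $\mathrm{PG}(6,q)$ have homogeneous coordinates $(x_0,\dots,x_6)$. Every $c\in\mathbb{F}_{q^2}$ is written uniquely as $c=c_0+\epsilon c_1$ with $c_0,c_1\in\mathbb{F}_q$. For a point $P=(0,u,v,w)$ of the plane $J=0$, $r_P$ denotes the line of the hyperplane $x_0=0$ of $\mathrm{PG}(6,q)$ consisting of the points $(0,u'_0,u'_1,v'_0,v'_1,w'_0,w'_1)$ with $(u',v',w')=(\lambda u,\lambda v,\lambda w)$, $\lambda\in\mathbb{F}_{q^2}^*$ (the spread line associated with $P$ in the Barlotti--Cofman representation of $\mathrm{PG}(3,q^2)$ in $\mathrm{PG}(6,q)$). -}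

module Defs where

open import Level using (_⊔_)
open import Data.Nat as ℕ using (ℕ; suc)
open import Data.Nat.Divisibility using (_∣_)
open import Data.Nat.Primality using (Prime)
open import Data.Fin using (Fin; #_)
open import Data.Product using (Σ; ∃; ∃-syntax; _×_; _,_)
open import Relation.Nullary using (¬_)
open import Relation.Binary.PropositionalEquality using (_≡_)
open import Function.Bundles using (_⇔_)
open import Algebra.Bundles using (CommutativeRing; Semiring)
import Algebra.Definitions.RawSemiring as RS

OddPrimePower : ℕ → Set
OddPrimePower q = ∃[ p ] ∃[ k ] (Prime p × q ≡ p ℕ.^ suc k × ¬ (2 ∣ q))

module Setup {c ℓ} (K : CommutativeRing c ℓ) where
  open CommutativeRing K
  open RS (Semiring.rawSemiring semiring) using (_^_) public

  IsField : Set (c ⊔ ℓ)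
  IsField = (¬ (0# ≈ 1#)) × (∀ x → ¬ (x ≈ 0#) → ∃[ y ] (x * y ≈ 1#))

  HasSize : ℕ → Set (c ⊔ ℓ)
  HasSize n = Σ (Fin n → Carrier) λ e →
    (∀ i j → e i ≈ e j → i ≡ j) × (∀ x → ∃[ i ] (e i ≈ x))

  module Geometry (q : ℕ) (ε : Carrier) where
    -- the subfield F_q of F_{q^2} = K : elements fixed by x ↦ x^q
    InFq : Carrier → Set ℓ
    InFq x = x ^ q ≈ x

    EpsilonCondition : Set ℓ
    EpsilonCondition = (¬ InFq ε) × (ε ^ q ≈ - ε)

    δ : Carrier
    δ = ε * ε

    -- homogeneous coordinate vectors of PG(3,q^2): (J,X,Y,Z) = (p 0, p 1, p 2, p 3)
    Vec4 : Set c
    Vec4 = Fin 4 → Carrier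

    NonZero4 : Vec4 → Set ℓ
    NonZero4 p = ¬ (∀ i → p i ≈ 0#)

    SamePoint4 : Vec4 → Vec4 → Set (c ⊔ ℓ)
    SamePoint4 p p' = ∃[ μ ] (¬ (μ ≈ 0#) × (∀ i → p' i ≈ μ * p i))

    In𝓕 : Vec4 → Set ℓ
    In𝓕 p = NonZero4 p × (p (# 0) ≈ 0#) ×
            ((p (# 1) ^ suc q) + (p (# 2) ^ suc q) ≈ 0#)

    Vec7 : Set c
    Vec7 = Fin 7 → Carrier

    Point6 : Vec7 → Set ℓ
    Point6 x = (∀ i → InFq (x i)) × ¬ (∀ i → x i ≈ 0#)

    -- x lies on r_P, P = (0,u,v,w): x = (0,u'_0,u'_1,v'_0,v'_1,w'_0,w'_1)
    -- with (u',v',w') = λ(u,v,w), λ ≠ 0, and c' = c'_0 + ε c'_1.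
    OnLine : Vec4 → Vec7 → Set (c ⊔ ℓ)
    OnLine p x = (x (# 0) ≈ 0#) × ∃[ λ' ] (¬ (λ' ≈ 0#) ×
                   (λ' * p (# 1) ≈ x (# 1) + ε * x (# 2)) ×
                   (λ' * p (# 2) ≈ x (# 3) + ε * x (# 4)) ×
                   (λ' * p (# 3) ≈ x (# 5) + ε * x (# 6)))

    OnQuadric : Vec7 → Set ℓ
    OnQuadric x = (x (# 0) ≈ 0#) ×
      (x (# 1) * x (# 1) - δ * (x (# 2) * x (# 2))
        + x (# 3) * x (# 3) - δ * (x (# 4) * x (# 4)) ≈ 0#)

    LinesPartitionQuadric : Set (c ⊔ ℓ)
    LinesPartitionQuadric =
      (∀ x → Point6 x → (OnQuadric x ⇔ (∃[ p ] (In𝓕 p × OnLine p x)))) ×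
      (∀ p p' x → In𝓕 p → In𝓕 p' → Point6 x → OnLine p x → OnLine p' x → SamePoint4 p p')

{-# OPTIONS --safe #-}
module Submission where

-- K has characteristic p, since q² · 1 ≈ 0 in an additive group of order q² = p ^ (2k + 2).
-- As p divides the inner binomial coefficients p C k, z ↦ z ^ q is additive; it fixes
-- F_q and sends ε to -ε, so the norm N z = z ^ (q + 1) satisfies N (a + ε b) = a² - δ b² on F_q.
-- Since 1 and ε are independent over F_q, a point x with x₀ = 0 lies on r_P exactly when P is
-- proportional to (0, x₁ + ε x₂, x₃ + ε x₄, x₅ + ε x₆), and the equation of the quadric then reads
-- N (x₁ + ε x₂) + N (x₃ + ε x₄) = 0, the equation of 𝓕 multiplied by N λ.

open import Defs
open import Data.Nat using (ℕ; _^_)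
open import Algebra.Bundles using (CommutativeRing)

open import Level using (_⊔_)
import Data.Nat as ℕ
open import Data.Nat using (zero; suc; _∸_; _<_; _≤_; z<s; s<s; NonZero; _!; nonTrivial⇒≢1; ≢-nonZero⁻¹)
open import Data.Nat.Properties
  using (<⇒≤; <⇒≱; <-trans; n<1+n; ∸-monoʳ-<; n∸n≡0; ^-*-assoc; _!*_!≢0)
open import Data.Nat.Divisibility using (_∣_; _∤_; divides; ∣⇒≤; ∣1⇒≡1; m∣m*n)
open import Data.Nat.DivMod using (m/n*n≡m)
open import Data.Nat.Primality using (Prime; euclidsLemma; prime⇒nonZero; prime⇒nonTrivial)
open import Data.Nat.Combinatorics using (_C_; nCn≡1; k![n∸k]!∣n!)
open import Data.Nat.Combinatorics.Specification using (nCk≡n!/k![n-k]!)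
open import Data.Fin using (Fin; fromℕ; inject₁; toℕ)
open import Data.Fin.Patterns using (0F; 1F; 2F; 3F; 4F; 5F; 6F)
open import Data.Fin.Properties using (toℕ-fromℕ; toℕ-inject₁; toℕ<n) renaming (_≟_ to _≟ᶠ_)
open import Data.Fin.Permutation using (Permutation′; permutation)
open import Data.Product using (∃-syntax; _×_; _,_; proj₁; proj₂)
open import Data.Sum using (inj₁; inj₂)
open import Data.Vec.Functional using (replicate)
open import Function.Base using (_∘_)
open import Function.Bundles using (mk⇔)
open import Relation.Nullary using (¬_; yes; no; contradiction)
open import Relation.Binary.Definitions using (Decidable)
open import Relation.Binary.PropositionalEquality as ≡ using (_≡_)
import Algebra.Properties.AbelianGroup as AbelianGroupProperties
import Algebra.Properties.CommutativeMonoid.Sum as SumProperties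
import Algebra.Properties.CommutativeSemigroup as CommutativeSemigroupProperties
import Algebra.Properties.CommutativeSemiring.Binomial as BinomialProperties
import Algebra.Properties.CommutativeSemiring.Exp as ExpProperties
import Algebra.Properties.Ring as RingProperties
import Algebra.Properties.Semiring.Mult as MultProperties
import Algebra.Properties.Semiring.Exp as SemiringExpProperties
import Relation.Binary.Reasoning.Setoid as SetoidReasoning

module BinomialCoefficients where

  open import Data.Nat using (_*_)

  prime∤m! : ∀ {p m} → Prime p → m < p → p ∤ m !
  prime∤m! {m = zero} p-prime _ p∣1 = nonTrivial⇒≢1 {{prime⇒nonTrivial p-prime}} (∣1⇒≡1 p∣1)
  prime∤m! {m = suc m} p-prime 1+m<p p∣[1+m]! with euclidsLemma (suc m) (m !) p-prime p∣[1+m]!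
  ... | inj₁ p∣1+m = <⇒≱ 1+m<p (∣⇒≤ p∣1+m)
  ... | inj₂ p∣m! = prime∤m! p-prime (<-trans (n<1+n m) 1+m<p) p∣m!

  n∣n! : ∀ n → .{{NonZero n}} → n ∣ n !
  n∣n! (suc n) = m∣m*n (n !)

  nCk*k![n∸k]!≡n! : ∀ {n k} → k ≤ n → (n C k) * (k ! * (n ∸ k) !) ≡ n !
  nCk*k![n∸k]!≡n! {n} {k} k≤n = ≡.trans
    (≡.cong (_* (k ! * (n ∸ k) !)) (nCk≡n!/k![n-k]! k≤n))
    (m/n*n≡m {{k !* (n ∸ k) !≢0}} (k![n∸k]!∣n! k≤n))

  prime∣pCk : ∀ {p k} → Prime p → 0 < k → k < p → p ∣ p C k
  prime∣pCk {p} {k} p-prime 0<k k<p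
    with euclidsLemma (p C k) (k ! * (p ∸ k) !) p-prime p∣pCk*k![p∸k]!
    where
    p∣pCk*k![p∸k]! : p ∣ (p C k) * (k ! * (p ∸ k) !)
    p∣pCk*k![p∸k]! = ≡.subst (p ∣_) (≡.sym (nCk*k![n∸k]!≡n! (<⇒≤ k<p)))
                                    (n∣n! p {{prime⇒nonZero p-prime}})
  ... | inj₁ p∣pCk = p∣pCk
  ... | inj₂ p∣k![p∸k]! with euclidsLemma (k !) ((p ∸ k) !) p-prime p∣k![p∸k]!
  ...   | inj₁ p∣k! = contradiction p∣k! (prime∤m! p-prime k<p)
  ...   | inj₂ p∣[p∸k]! = contradiction p∣[p∸k]! (prime∤m! p-prime (∸-monoʳ-< 0<k (<⇒≤ k<p)))

open BinomialCoefficients using (prime∣pCk)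

module CommutativeRingProperties {c ℓ} (R : CommutativeRing c ℓ) where

  open CommutativeRing R
  open Setup R using () renaming (_^_ to _^ᴿ_)
  open MultProperties semiring using (×-congʳ; ×-homo-1; ×-assoc-*; ×1-homo-*)
    renaming (_×_ to _·_)
  open SemiringExpProperties semiring using (^-assocʳ; ^-congˡ)
  open SumProperties +-commutativeMonoid using (sum; sum-init-last; sum-cong-≋; sum-replicate-zero)
  open BinomialProperties commutativeSemiring using (binomialTerm; binomialExpansion; theorem)
  open RingProperties ring using (x+x≈x⇒x≈0; x[y-z]≈xy-xz)
  open AbelianGroupProperties +-abelianGroup using (\\-leftDividesʳ)
  open SetoidReasoning setoid

  [x+y][x-y]≈x²-y² : ∀ x y → (x + y) * (x - y) ≈ x * x - y * y
  [x+y][x-y]≈x²-y² x y = begin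
    (x + y) * (x - y)                     ≈⟨ distribʳ (x - y) x y ⟩
    x * (x - y) + y * (x - y)             ≈⟨ +-cong (x[y-z]≈xy-xz x x y) (x[y-z]≈xy-xz y x y) ⟩
    (x * x - x * y) + (y * x - y * y)     ≈⟨ +-congˡ (+-congʳ (*-comm y x)) ⟩
    (x * x - x * y) + (x * y - y * y)     ≈⟨ +-assoc (x * x) _ _ ⟩
    x * x + (- (x * y) + (x * y - y * y)) ≈⟨ +-congˡ (\\-leftDividesʳ (x * y) _) ⟩
    x * x - y * y                         ∎

  ^-Additive : ℕ → Set (c ⊔ ℓ)
  ^-Additive n = ∀ a b → (a + b) ^ᴿ n ≈ a ^ᴿ n + b ^ᴿ n

  ^-additive-1 : ^-Additive 1
  ^-additive-1 a b = distribʳ 1# a b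

  ^-additive-* : ∀ m n → ^-Additive m → ^-Additive n → ^-Additive (m ℕ.* n)
  ^-additive-* m n additive-m additive-n a b = begin
    (a + b) ^ᴿ (m ℕ.* n)            ≈⟨ ^-assocʳ (a + b) m n ⟨
    ((a + b) ^ᴿ m) ^ᴿ n             ≈⟨ ^-congˡ n (additive-m a b) ⟩
    (a ^ᴿ m + b ^ᴿ m) ^ᴿ n          ≈⟨ additive-n (a ^ᴿ m) (b ^ᴿ m) ⟩
    (a ^ᴿ m) ^ᴿ n + (b ^ᴿ m) ^ᴿ n   ≈⟨ +-cong (^-assocʳ a m n) (^-assocʳ b m n) ⟩
    a ^ᴿ (m ℕ.* n) + b ^ᴿ (m ℕ.* n) ∎

  ^-additive-^ : ∀ m → ^-Additive m → ∀ j → ^-Additive (m ^ j)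
  ^-additive-^ m additive-m zero = ^-additive-1
  ^-additive-^ m additive-m (suc j) = ^-additive-* m (m ^ j) additive-m (^-additive-^ m additive-m j)

  ^-additive⇒0^n≈0 : ∀ n → ^-Additive n → 0# ^ᴿ n ≈ 0#
  ^-additive⇒0^n≈0 n additive = x+x≈x⇒x≈0 (0# ^ᴿ n) (begin
    0# ^ᴿ n + 0# ^ᴿ n ≈⟨ additive 0# 0# ⟨
    (0# + 0#) ^ᴿ n   ≈⟨ ^-congˡ n (+-identityˡ 0#) ⟩
    0# ^ᴿ n          ∎)

  ×1-homo-^ : ∀ m n → (m ^ n) · 1# ≈ (m · 1#) ^ᴿ n
  ×1-homo-^ m zero = ×-homo-1 1#
  ×1-homo-^ m (suc n) = trans (×1-homo-* m (m ^ n)) (*-congˡ (×1-homo-^ m n))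

  sum-ends : ∀ m (t : Fin (suc (suc m)) → Carrier) → (∀ j → t (Fin.suc (inject₁ j)) ≈ 0#) →
             sum t ≈ t 0F + t (fromℕ (suc m))
  sum-ends m t interior≈0 = +-congˡ (begin
    sum (t ∘ Fin.suc)                               ≈⟨ sum-init-last (t ∘ Fin.suc) ⟩
    sum (t ∘ Fin.suc ∘ inject₁) + t (fromℕ (suc m)) ≈⟨ +-congʳ (sum-cong-≋ interior≈0) ⟩
    sum (replicate m 0#) + t (fromℕ (suc m))        ≈⟨ +-congʳ (sum-replicate-zero m) ⟩
    0# + t (fromℕ (suc m))                          ≈⟨ +-identityˡ _ ⟩
    t (fromℕ (suc m))                               ∎)

  ∣⇒·1≈0 : ∀ {m n} → m · 1# ≈ 0# → m ∣ n → n · 1# ≈ 0#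
  ∣⇒·1≈0 {m} m·1≈0 (divides d ≡.refl) = begin
    (d ℕ.* m) · 1#      ≈⟨ ×1-homo-* d m ⟩
    (d · 1#) * (m · 1#) ≈⟨ *-congˡ m·1≈0 ⟩
    (d · 1#) * 0#       ≈⟨ zeroʳ _ ⟩
    0#                  ∎

  ·1≈0⇒·≈0 : ∀ n → n · 1# ≈ 0# → ∀ x → n · x ≈ 0#
  ·1≈0⇒·≈0 n n·1≈0 x = begin
    n · x        ≈⟨ ×-congʳ n (*-identityˡ x) ⟨
    n · (1# * x) ≈⟨ ×-assoc-* n 1# x ⟨
    (n · 1#) * x ≈⟨ *-congʳ n·1≈0 ⟩
    0# * x       ≈⟨ zeroˡ x ⟩
    0#           ∎

  binomialTerm-last : ∀ a b n → binomialTerm a b n (fromℕ n) ≈ a ^ᴿ n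
  binomialTerm-last a b n rewrite toℕ-fromℕ n | nCn≡1 n | n∸n≡0 n =
    trans (+-identityʳ _) (*-identityʳ _)

  frobenius : ∀ {p} → Prime p → p · 1# ≈ 0# → ^-Additive p
  frobenius {zero} p-prime _ = contradiction ≡.refl (≢-nonZero⁻¹ 0 {{prime⇒nonZero p-prime}})
  frobenius {suc m} p-prime p·1≈0 a b = begin
    (a + b) ^ᴿ suc m
      ≈⟨ theorem (suc m) a b ⟩
    binomialExpansion a b (suc m)
      ≈⟨ sum-ends m (binomialTerm a b (suc m)) interior≈0 ⟩
    binomialTerm a b (suc m) 0F + binomialTerm a b (suc m) (fromℕ (suc m))
      ≈⟨ +-cong (trans (+-identityʳ _) (*-identityˡ _)) (binomialTerm-last a b (suc m)) ⟩
    b ^ᴿ suc m + a ^ᴿ suc m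
      ≈⟨ +-comm _ _ ⟩
    a ^ᴿ suc m + b ^ᴿ suc m
      ∎
    where
    interior≈0 : ∀ j → binomialTerm a b (suc m) (Fin.suc (inject₁ j)) ≈ 0#
    interior≈0 j = ·1≈0⇒·≈0 (suc m C k) (∣⇒·1≈0 p·1≈0 (prime∣pCk p-prime z<s k<1+m)) _
      where
      k : ℕ
      k = suc (toℕ (inject₁ j))
      k<1+m : k < suc m
      k<1+m = s<s (≡.subst (_< m) (≡.sym (toℕ-inject₁ j)) (toℕ<n j))

module FiniteRingProperties {c ℓ} (R : CommutativeRing c ℓ) {n} (size : Setup.HasSize R n) where

  open CommutativeRing R
  open MultProperties semiring using () renaming (_×_ to _·_)
  open SumProperties +-commutativeMonoid using (sum; sum-permute; sum-cong-≋; ∑-distrib-+; sum-replicate)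
  open AbelianGroupProperties +-abelianGroup using (identityʳ-unique; //-rightDividesˡ; //-rightDividesʳ)
  open SetoidReasoning setoid

  private
    enum : Fin n → Carrier
    enum = proj₁ size

    enum-injective : ∀ i j → enum i ≈ enum j → i ≡ j
    enum-injective = proj₁ (proj₂ size)

    index : Carrier → Fin n
    index x = proj₁ (proj₂ (proj₂ size) x)

    enum-index : ∀ x → enum (index x) ≈ x
    enum-index x = proj₂ (proj₂ (proj₂ size) x)

  _≟_ : Decidable _≈_
  x ≟ y with index x ≟ᶠ index y
  ... | yes i≡j = yes (begin
    x              ≈⟨ enum-index x ⟨
    enum (index x) ≡⟨ ≡.cong enum i≡j ⟩
    enum (index y) ≈⟨ enum-index y ⟩
    y              ∎)
  ... | no i≢j = no λ x≈y →
    i≢j (enum-injective _ _ (trans (enum-index x) (trans x≈y (sym (enum-index y)))))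

  translation : Carrier → Permutation′ n
  translation x = permutation (λ i → index (enum i + x)) (λ i → index (enum i - x))
    (λ i → enum-injective _ _ (begin
      enum (index (enum (index (enum i - x)) + x)) ≈⟨ enum-index _ ⟩
      enum (index (enum i - x)) + x                ≈⟨ +-congʳ (enum-index _) ⟩
      (enum i - x) + x                             ≈⟨ //-rightDividesˡ x (enum i) ⟩
      enum i                                       ∎))
    (λ i → enum-injective _ _ (begin
      enum (index (enum (index (enum i + x)) - x)) ≈⟨ enum-index _ ⟩
      enum (index (enum i + x)) - x                ≈⟨ +-congʳ (enum-index _) ⟩
      (enum i + x) - x                             ≈⟨ //-rightDividesʳ x (enum i) ⟩
      enum i                                       ∎))

  -- Translating by x permutes the elements, so their sum s satisfies s ≈ s + n · x.
  n·x≈0 : ∀ x → n · x ≈ 0#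
  n·x≈0 x = identityʳ-unique (sum enum) (n · x) (sym (begin
    sum enum                              ≈⟨ sum-permute enum (translation x) ⟩
    sum (λ i → enum (index (enum i + x))) ≈⟨ sum-cong-≋ (λ i → enum-index (enum i + x)) ⟩
    sum (λ i → enum i + x)                ≈⟨ ∑-distrib-+ enum (λ _ → x) ⟩
    sum enum + sum (replicate n x)        ≈⟨ +-congˡ (sum-replicate n) ⟩
    sum enum + n · x                      ∎))

module FieldProperties {c ℓ} (K : CommutativeRing c ℓ) (isField : Setup.IsField K) where

  open CommutativeRing K
  open MultProperties semiring using () renaming (_×_ to _·_)
  open CommutativeRingProperties K using (×1-homo-^)
  open Setup K using () renaming (_^_ to _^ᴿ_)
  open SetoidReasoning setoid

  1≉0 : ¬ (1# ≈ 0#)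
  1≉0 1≈0 = proj₁ isField (sym 1≈0)

  x≉0∧x*y≈0⇒y≈0 : ∀ {x y} → ¬ (x ≈ 0#) → x * y ≈ 0# → y ≈ 0#
  x≉0∧x*y≈0⇒y≈0 {x} {y} x≉0 x*y≈0 with proj₂ isField x x≉0
  ... | x⁻¹ , x*x⁻¹≈1 = begin
    y             ≈⟨ *-identityˡ y ⟨
    1# * y        ≈⟨ *-congʳ (trans (sym x*x⁻¹≈1) (*-comm x x⁻¹)) ⟩
    (x⁻¹ * x) * y ≈⟨ *-assoc x⁻¹ x y ⟩
    x⁻¹ * (x * y) ≈⟨ *-congˡ x*y≈0 ⟩
    x⁻¹ * 0#      ≈⟨ zeroʳ x⁻¹ ⟩
    0#            ∎

  x≉0∧y≉0⇒x*y≉0 : ∀ {x y} → ¬ (x ≈ 0#) → ¬ (y ≈ 0#) → ¬ (x * y ≈ 0#)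
  x≉0∧y≉0⇒x*y≉0 x≉0 y≉0 x*y≈0 = y≉0 (x≉0∧x*y≈0⇒y≈0 x≉0 x*y≈0)

  x^n≈0⇒x≈0 : Decidable _≈_ → ∀ x n → x ^ᴿ n ≈ 0# → x ≈ 0#
  x^n≈0⇒x≈0 _≟_ x zero 1≈0 = contradiction 1≈0 1≉0
  x^n≈0⇒x≈0 _≟_ x (suc n) x*xⁿ≈0 with x ≟ 0#
  ... | yes x≈0 = x≈0
  ... | no x≉0 = x^n≈0⇒x≈0 _≟_ x n (x≉0∧x*y≈0⇒y≈0 x≉0 x*xⁿ≈0)

  p^j-size⇒p·1≈0 : ∀ p j → .{{NonZero j}} → Setup.HasSize K (p ^ j) → p · 1# ≈ 0#
  p^j-size⇒p·1≈0 p j@(suc _) size =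
    x^n≈0⇒x≈0 _≟_ (p · 1#) j (trans (sym (×1-homo-^ p j)) (n·x≈0 1#))
    where open FiniteRingProperties K size using (_≟_; n·x≈0)

module BarlottiCofman {c ℓ} (K : CommutativeRing c ℓ) (isField : Setup.IsField K)
  (q : ℕ) (ε : CommutativeRing.Carrier K)
  (frobenius-q : CommutativeRingProperties.^-Additive K q)
  (ε-condition : Setup.Geometry.EpsilonCondition K q ε) where

  open CommutativeRing K
  open Setup K using () renaming (_^_ to _^ᴿ_)
  open Setup.Geometry K q ε
  open CommutativeRingProperties K using ([x+y][x-y]≈x²-y²; ^-additive⇒0^n≈0)
  open FieldProperties K isField using (1≉0; x≉0∧x*y≈0⇒y≈0; x≉0∧y≉0⇒x*y≉0)
  open ExpProperties commutativeSemiring using (^-distrib-*)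
  open SemiringExpProperties semiring using (^-congˡ)
  open RingProperties ring using (-‿distribˡ-*)
  open AbelianGroupProperties +-abelianGroup using (inverseʳ-unique; x∙y⁻¹≈ε⇒x≈y)
  open CommutativeSemigroupProperties *-commutativeSemigroup using (interchange)
  open SetoidReasoning setoid

  norm : Carrier → Carrier
  norm z = z ^ᴿ suc q

  norm-* : ∀ x y → norm (x * y) ≈ norm x * norm y
  norm-* x y = ^-distrib-* x y (suc q)

  conjugate : ∀ {a b} → InFq a → InFq b → (a + ε * b) ^ᴿ q ≈ a - ε * b
  conjugate {a} {b} a∈Fq b∈Fq = begin
    (a + ε * b) ^ᴿ q      ≈⟨ frobenius-q a (ε * b) ⟩
    a ^ᴿ q + (ε * b) ^ᴿ q ≈⟨ +-cong a∈Fq (^-distrib-* ε b q) ⟩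
    a + ε ^ᴿ q * b ^ᴿ q   ≈⟨ +-congˡ (*-cong (proj₂ ε-condition) b∈Fq) ⟩
    a + - ε * b           ≈⟨ +-congˡ (-‿distribˡ-* ε b) ⟨
    a - ε * b             ∎

  norm-a+εb : ∀ {a b} → InFq a → InFq b → norm (a + ε * b) ≈ a * a - δ * (b * b)
  norm-a+εb {a} {b} a∈Fq b∈Fq = begin
    (a + ε * b) * (a + ε * b) ^ᴿ q ≈⟨ *-congˡ (conjugate a∈Fq b∈Fq) ⟩
    (a + ε * b) * (a - ε * b)      ≈⟨ [x+y][x-y]≈x²-y² a (ε * b) ⟩
    a * a - (ε * b) * (ε * b)      ≈⟨ +-congˡ (-‿cong (interchange ε b ε b)) ⟩
    a * a - δ * (b * b)            ∎

  ε+ε≉0 : ¬ (ε + ε ≈ 0#)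
  ε+ε≉0 ε+ε≈0 = proj₁ ε-condition (trans (proj₂ ε-condition) (sym (inverseʳ-unique ε ε ε+ε≈0)))

  a+εb≈0⇒a≈0∧b≈0 : ∀ {a b} → InFq a → InFq b → a + ε * b ≈ 0# → a ≈ 0# × b ≈ 0#
  a+εb≈0⇒a≈0∧b≈0 {a} {b} a∈Fq b∈Fq a+εb≈0 = a≈0 , b≈0
    where
    a≈εb : a ≈ ε * b
    a≈εb = x∙y⁻¹≈ε⇒x≈y a (ε * b) (begin
      a - ε * b         ≈⟨ conjugate a∈Fq b∈Fq ⟨
      (a + ε * b) ^ᴿ q  ≈⟨ ^-congˡ q a+εb≈0 ⟩
      0# ^ᴿ q           ≈⟨ ^-additive⇒0^n≈0 q frobenius-q ⟩
      0#                ∎)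
    b≈0 : b ≈ 0#
    b≈0 = x≉0∧x*y≈0⇒y≈0 ε+ε≉0 (begin
      (ε + ε) * b      ≈⟨ distribʳ b ε ε ⟩
      ε * b + ε * b    ≈⟨ +-congʳ a≈εb ⟨
      a + ε * b        ≈⟨ a+εb≈0 ⟩
      0#               ∎)
    a≈0 : a ≈ 0#
    a≈0 = trans a≈εb (trans (*-congˡ b≈0) (zeroʳ ε))

  pointOf : Vec7 → Vec4
  pointOf x 0F = 0#
  pointOf x 1F = x 1F + ε * x 2F
  pointOf x 2F = x 3F + ε * x 4F
  pointOf x 3F = x 5F + ε * x 6F

  onLine-pointOf : ∀ x → x 0F ≈ 0# → OnLine (pointOf x) x
  onLine-pointOf x x₀≈0 = x₀≈0 , 1# , 1≉0 , *-identityˡ _ , *-identityˡ _ , *-identityˡ _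

  pointOf-nonZero : ∀ x → Point6 x → x 0F ≈ 0# → NonZero4 (pointOf x)
  pointOf-nonZero x (x∈Fq , x≉0) x₀≈0 pointOf≈0 = x≉0 x≈0
    where
    coordinates≈0 : ∀ {i j} → x i + ε * x j ≈ 0# → x i ≈ 0# × x j ≈ 0#
    coordinates≈0 = a+εb≈0⇒a≈0∧b≈0 (x∈Fq _) (x∈Fq _)
    x≈0 : ∀ i → x i ≈ 0#
    x≈0 0F = x₀≈0
    x≈0 1F = proj₁ (coordinates≈0 (pointOf≈0 1F))
    x≈0 2F = proj₂ (coordinates≈0 (pointOf≈0 1F))
    x≈0 3F = proj₁ (coordinates≈0 (pointOf≈0 2F))
    x≈0 4F = proj₂ (coordinates≈0 (pointOf≈0 2F))
    x≈0 5F = proj₁ (coordinates≈0 (pointOf≈0 3F))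
    x≈0 6F = proj₂ (coordinates≈0 (pointOf≈0 3F))

  quadric≈norm+norm : ∀ x → (∀ i → InFq (x i)) →
    x 1F * x 1F - δ * (x 2F * x 2F) + x 3F * x 3F - δ * (x 4F * x 4F)
      ≈ norm (pointOf x 1F) + norm (pointOf x 2F)
  quadric≈norm+norm x x∈Fq = trans (+-assoc _ _ _)
    (sym (+-cong (norm-a+εb (x∈Fq 1F) (x∈Fq 2F)) (norm-a+εb (x∈Fq 3F) (x∈Fq 4F))))

  onQuadric⇒onLine : ∀ x → Point6 x → OnQuadric x → ∃[ p ] (In𝓕 p × OnLine p x)
  onQuadric⇒onLine x x∈PG@(x∈Fq , _) (x₀≈0 , Q≈0) =
    pointOf x ,
    (pointOf-nonZero x x∈PG x₀≈0 , refl , trans (sym (quadric≈norm+norm x x∈Fq)) Q≈0) ,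
    onLine-pointOf x x₀≈0

  onLine⇒onQuadric : ∀ {p} x → (∀ i → InFq (x i)) → In𝓕 p → OnLine p x → OnQuadric x
  onLine⇒onQuadric {p} x x∈Fq (_ , _ , normp₁+normp₂≈0) (x₀≈0 , μ , _ , μp₁≈ , μp₂≈ , _) =
    x₀≈0 , (begin
      x 1F * x 1F - δ * (x 2F * x 2F) + x 3F * x 3F - δ * (x 4F * x 4F)
        ≈⟨ quadric≈norm+norm x x∈Fq ⟩
      norm (pointOf x 1F) + norm (pointOf x 2F)
        ≈⟨ +-cong (^-congˡ (suc q) μp₁≈) (^-congˡ (suc q) μp₂≈) ⟨
      norm (μ * p 1F) + norm (μ * p 2F)
        ≈⟨ +-cong (norm-* μ (p 1F)) (norm-* μ (p 2F)) ⟩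
      norm μ * norm (p 1F) + norm μ * norm (p 2F)
        ≈⟨ distribˡ (norm μ) _ _ ⟨
      norm μ * (norm (p 1F) + norm (p 2F))
        ≈⟨ *-congˡ normp₁+normp₂≈0 ⟩
      norm μ * 0#
        ≈⟨ zeroʳ _ ⟩
      0# ∎)

  rescale : ∀ {μ μ′ ν u u′ w} → ν * μ′ ≈ 1# → μ * u ≈ w → μ′ * u′ ≈ w → u′ ≈ (ν * μ) * u
  rescale {μ} {μ′} {ν} {u} {u′} νμ′≈1 μu≈w μ′u′≈w = begin
    u′            ≈⟨ *-identityˡ u′ ⟨
    1# * u′       ≈⟨ *-congʳ νμ′≈1 ⟨
    (ν * μ′) * u′ ≈⟨ *-assoc ν μ′ u′ ⟩
    ν * (μ′ * u′) ≈⟨ *-congˡ (trans μ′u′≈w (sym μu≈w)) ⟩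
    ν * (μ * u)   ≈⟨ *-assoc ν μ u ⟨
    (ν * μ) * u   ∎

  onLine-unique : ∀ {p p′ x} → p 0F ≈ 0# → p′ 0F ≈ 0# → OnLine p x → OnLine p′ x → SamePoint4 p p′
  onLine-unique {p} {p′} p₀≈0 p′₀≈0 (_ , μ , μ≉0 , e₁ , e₂ , e₃) (_ , μ′ , μ′≉0 , e₁′ , e₂′ , e₃′)
    with proj₂ isField μ′ μ′≉0
  ... | ν , μ′ν≈1 = ν * μ , x≉0∧y≉0⇒x*y≉0 ν≉0 μ≉0 , p′≈νμp
    where
    νμ′≈1 : ν * μ′ ≈ 1#
    νμ′≈1 = trans (*-comm ν μ′) μ′ν≈1
    ν≉0 : ¬ (ν ≈ 0#)
    ν≉0 ν≈0 = 1≉0 (trans (sym νμ′≈1) (trans (*-congʳ ν≈0) (zeroˡ μ′)))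
    p′≈νμp : ∀ i → p′ i ≈ (ν * μ) * p i
    p′≈νμp 0F = trans p′₀≈0 (sym (trans (*-congˡ p₀≈0) (zeroʳ _)))
    p′≈νμp 1F = rescale νμ′≈1 e₁ e₁′
    p′≈νμp 2F = rescale νμ′≈1 e₂ e₂′
    p′≈νμp 3F = rescale νμ′≈1 e₃ e₃′

  linesPartitionQuadric : LinesPartitionQuadric
  linesPartitionQuadric =
    (λ x x∈PG → mk⇔ (onQuadric⇒onLine x x∈PG)
                    (λ (p , p∈𝓕 , x∈rₚ) → onLine⇒onQuadric x (proj₁ x∈PG) p∈𝓕 x∈rₚ)) ,
    (λ p p′ x (_ , p₀≈0 , _) (_ , p′₀≈0 , _) _ → onLine-unique {x = x} p₀≈0 p′₀≈0)

proposition5p3 : ∀ {c ℓ} (K : CommutativeRing c ℓ) (q : ℕ) → OddPrimePower q →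
    Setup.IsField K → Setup.HasSize K (q ^ 2) →
    (ε : CommutativeRing.Carrier K) → Setup.Geometry.EpsilonCondition K q ε →
    Setup.Geometry.LinesPartitionQuadric K q ε
proposition5p3 K q (p , k , p-prime , ≡.refl , _) isField size ε ε-condition =
  BarlottiCofman.linesPartitionQuadric K isField q ε frobenius-q ε-condition
  where
  open CommutativeRingProperties K using (^-Additive; frobenius; ^-additive-^)
  open FieldProperties K isField using (p^j-size⇒p·1≈0)

  frobenius-q : ^-Additive q
  frobenius-q = ^-additive-^ p (frobenius p-prime (p^j-size⇒p·1≈0 p (suc k ℕ.* 2) size′)) (suc k)
    where
    size′ : Setup.HasSize K (p ^ (suc k ℕ.* 2))
    size′ = ≡.subst (Setup.HasSize K) (^-*-assoc p (suc k) 2) size
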